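{- Let $I$ be a countable index set and let $S$ be the direct sum of finite semigroups $M_i$ ($i\in I$). Then $S$ is $\aleph_0$-categorical if and only if $I$ is finite (in which case $S$ is finite).
   Context: A countable semigroup $S$ is $\aleph_0$-categorical if for every $n\geq1$ the coordinatewise action of $\operatorname{Aut}(S)$ on $S^n$ has only finitely many orbits. For semigroups $M_i$ ($i\in I$), their direct sum is the semigroup given by the presentation $S=\langle \bigcup_{i\in I}\overline{M_i} : \overline{m_i}\,\overline{m_i'}=\overline{m_im_i'},\ \overline{m_i}\,\overline{m_j}=\overline{m_j}\,\overline{m_i}\ (i\neq j,\ m_i,m_i'\in M_i,\ m_j\in M_j)\rangle$, where $\overline{M_i}=\{\overline{m_i}:m_i\in M_i\}$ are disjoint copies of the $M_i$. -}

module Defs where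

open import Level using (0ℓ)
open import Data.Nat using (ℕ)
open import Data.Fin using (Fin)
open import Data.Product using (Σ; ∃; ∃-syntax; _×_; _,_)
open import Data.Sum using (_⊎_)
open import Data.List.NonEmpty using (List⁺; [_]; _∷_; _⁺++⁺_)
open import Data.List using ([])
open import Data.List.NonEmpty.Properties using (⁺++⁺-assoc)
open import Relation.Nullary using (¬_)
open import Relation.Binary using (Setoid; IsEquivalence)
open import Relation.Binary.PropositionalEquality as ≡ using (_≡_)
open import Function.Bundles using (Inverse; _↔_)
open import Algebra.Bundles using (Semigroup)
open import Algebra.Structures using (IsSemigroup; IsMagma)

FiniteType : Set → Set
FiniteType I = ∃[ n ] (I ↔ Fin n)

Countable : Set → Set
Countable I = FiniteType I ⊎ (I ↔ ℕ)

FiniteSetoid : Setoid 0ℓ 0ℓ → Set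
FiniteSetoid A = ∃[ n ] Inverse (≡.setoid (Fin n)) A

FiniteSemigroup : Semigroup 0ℓ 0ℓ → Set
FiniteSemigroup M = FiniteSetoid (Semigroup.setoid M)

record Automorphism (S : Semigroup 0ℓ 0ℓ) : Set where
  open Semigroup S
  field
    bij : Inverse setoid setoid
  open Inverse bij public using (to; from)
  field
    hom : ∀ x y → to (x ∙ y) ≈ to x ∙ to y

FinitelyManyOrbits : (S : Semigroup 0ℓ 0ℓ) → ℕ → Set
FinitelyManyOrbits S n =
  ∃[ k ] Σ (Fin k → (Fin n → Semigroup.Carrier S)) λ reps →
    ∀ (t : Fin n → Semigroup.Carrier S) →
      ∃[ j ] Σ (Automorphism S) λ α →
        ∀ (l : Fin n) → Semigroup._≈_ S (Automorphism.to α (reps j l)) (t l)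

ℵ₀-categorical : Semigroup 0ℓ 0ℓ → Set
ℵ₀-categorical S = ∀ (n : ℕ) → 1 Data.Nat.≤ n → FinitelyManyOrbits S n
  where import Data.Nat

-- Direct sum of semigroups, by the presentation
--   < ⋃ M̄ᵢ | m̄ m̄' = (mm')‾ , m̄ᵢ m̄ⱼ = m̄ⱼ m̄ᵢ (i ≠ j) >
-- realised as nonempty words over the generators modulo the congruence
-- generated by the defining relations (as a setoid).

module DirectSum {I : Set} (M : I → Semigroup 0ℓ 0ℓ) where

  open Semigroup using (Carrier)

  Gen : Set
  Gen = Σ I λ i → Carrier (M i)

  Word : Set
  Word = List⁺ Gen

  gen : (i : I) → Carrier (M i) → Word
  gen i m = [ (i , m) ]

  data _~_ : Word → Word → Set where
    rel-eq   : ∀ {i} {m m′ : Carrier (M i)} → Semigroup._≈_ (M i) m m′ →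
               gen i m ~ gen i m′
    rel-mul  : ∀ {i} (m m′ : Carrier (M i)) →
               (gen i m ⁺++⁺ gen i m′) ~ gen i (Semigroup._∙_ (M i) m m′)
    rel-comm : ∀ {i j} → ¬ (i ≡ j) → (m : Carrier (M i)) (n : Carrier (M j)) →
               (gen i m ⁺++⁺ gen j n) ~ (gen j n ⁺++⁺ gen i m)
    ~-refl   : ∀ {u} → u ~ u
    ~-sym    : ∀ {u v} → u ~ v → v ~ u
    ~-trans  : ∀ {u v w} → u ~ v → v ~ w → u ~ w
    ~-congˡ  : ∀ {u v} (w : Word) → u ~ v → (w ⁺++⁺ u) ~ (w ⁺++⁺ v)
    ~-congʳ  : ∀ {u v} (w : Word) → u ~ v → (u ⁺++⁺ w) ~ (v ⁺++⁺ w)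

  private
    ~-isEquivalence : IsEquivalence _~_
    ~-isEquivalence = record { refl = ~-refl ; sym = ~-sym ; trans = ~-trans }

    ~-cong : ∀ {u u′ v v′} → u ~ u′ → v ~ v′ → (u ⁺++⁺ v) ~ (u′ ⁺++⁺ v′)
    ~-cong {u} {u′} {v} {v′} p q = ~-trans (~-congʳ v p) (~-congˡ u′ q)

    ≡⇒~ : ∀ {u v} → u ≡ v → u ~ v
    ≡⇒~ ≡.refl = ~-refl

  directSum : Semigroup 0ℓ 0ℓ
  directSum = record
    { Carrier = Word
    ; _≈_ = _~_
    ; _∙_ = _⁺++⁺_
    ; isSemigroup = record
      { isMagma = record { isEquivalence = ~-isEquivalence ; ∙-cong = ~-cong }
      ; assoc = λ x y z → ≡⇒~ (⁺++⁺-assoc x y z)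
      }
    }

open DirectSum public using (directSum)

module Submission where

-- Everything rests on a normal form theorem.  The k-component of a word is
-- the product, in Mₖ with an identity adjoined, of its letters from Mₖ.
-- Components are invariants of the defining congruence ('component-resp'),
-- and conversely every word equals the product of its components along any
-- list of indices covering its letters ('normalForm-correct'), so words
-- with equal components are equal ('complete').  Hence the words with
-- letters from a finite list L of factors form finitely many classes
-- ('coveredWords').
--
-- For infinite I (module InfiniteIndex) let
-- r₀,…,r_{k-1} represent the Aut(S)-orbits on S, L the union of their
-- supports and K the number of classes of words over L.  A word w with K+1
-- letters from distinct factors is α(rⱼ) for some automorphism α; the
-- preimages of its letters are factors of rⱼ, hence words over L, so two of
-- them coincide, and so do two letters from distinct factors -- impossible,
-- as their components differ.

open import Defs
open import Level using (0ℓ)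
open import Data.Product using (_×_)
open import Function.Bundles using (_⇔_)
open import Algebra.Bundles using (Semigroup)

open import Data.Nat as ℕ using (ℕ; zero; suc; _^_; s≤s; z≤n)
open import Data.Nat.Properties using (n<1+n)
open import Data.Fin as Fin using (Fin; zero; suc; toℕ; remQuot; combine; finToFun; funToFin)
open import Data.Fin.Properties using (remQuot-combine; finToFun-funToFin; any?; pigeonhole; <⇒≢; toℕ-injective)
open import Data.Product using (Σ; ∃; ∃₂; _,_; proj₁; proj₂)
open import Data.Sum using ([_,_]′)
open import Data.Maybe using (Maybe; just; nothing)
open import Data.Maybe.Relation.Binary.Pointwise as Pointwise using (Pointwise; just; nothing; drop-just; nothing-inv)
open import Data.List using (List; []; _∷_; _++_; map; allFin)
open import Data.List.Properties using (++-identityʳ)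
open import Data.List.NonEmpty using (_∷_; toList; _⁺++⁺_; [_])
open import Data.List.Membership.Propositional using (_∈_; _∉_)
open import Data.List.Membership.Propositional.Properties using (∈-map⁺; ∈-allFin; ∈-++⁺ˡ; ∈-++⁺ʳ; ∈-∃++)
open import Data.List.Relation.Unary.Any using (here; there)
import Data.List.Relation.Unary.All as All
open import Data.Empty using (⊥; ⊥-elim)
open import Function using (_∘_)
open import Relation.Nullary using (¬_; yes; no)
open import Relation.Nullary.Decidable using (via-injection)
open import Relation.Binary using (Setoid; DecidableEquality; Decidable)
open import Relation.Binary.PropositionalEquality as ≡ using (_≡_; _≢_; refl)
open import Function.Bundles using (Inverse; Injection; _↔_; mk⇔)
open import Function.Properties.Inverse using (Inverse⇒Injection; ↔⇒↣)
import Function.Construct.Identity as Identity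
import Function.Construct.Symmetry as Symmetry
import Relation.Binary.Reasoning.Setoid as SetoidReasoning

module Enumeration (A : Setoid 0ℓ 0ℓ) where
  open Setoid A renaming (Carrier to X; refl to ≈-refl)

  Enumerates : {K : ℕ} → (Fin K → X) → Set
  Enumerates e = ∀ a → ∃ λ j → e j ≈ a

  Enumerable : Set
  Enumerable = ∃ λ K → Σ (Fin K → X) Enumerates

  finite⇒enumerable : FiniteSetoid A → Enumerable
  finite⇒enumerable (n , inv) = n , to , λ a → from a , strictlyInverseˡ a
    where open Inverse inv

  finite⇒decidable : FiniteSetoid A → Decidable _≈_
  finite⇒decidable (n , inv) = via-injection (Inverse⇒Injection (Symmetry.inverse inv)) Fin._≟_

  deduplicate : Decidable _≈_ → ∀ {K} (e : Fin K → X) →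
    ∃ λ N → Σ (Fin N → X) λ d → (∀ p q → d p ≈ d q → p ≡ q) × (∀ j → ∃ λ p → d p ≈ e j)
  deduplicate _≟_ {zero} e = 0 , (λ ()) , (λ ()) , (λ ())
  deduplicate _≟_ {suc K} e with deduplicate _≟_ (e ∘ suc)
  ... | N , d , injective , covers with any? (λ p → d p ≟ e zero)
  ... | yes (p , dp≈e₀) = N , d , injective , λ { zero → p , dp≈e₀ ; (suc j) → covers j }
  ... | no e₀-new = suc N , d′ , injective′ , covers′
    where
      d′ : Fin (suc N) → X
      d′ zero = e zero
      d′ (suc p) = d p

      injective′ : ∀ p q → d′ p ≈ d′ q → p ≡ q
      injective′ zero zero _ = refl
      injective′ zero (suc q) eq = ⊥-elim (e₀-new (q , sym eq))
      injective′ (suc p) zero eq = ⊥-elim (e₀-new (p , eq))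
      injective′ (suc p) (suc q) eq = ≡.cong suc (injective p q eq)

      covers′ : ∀ j → ∃ λ p → d′ p ≈ e j
      covers′ zero = zero , ≈-refl
      covers′ (suc j) = suc (proj₁ (covers j)) , proj₂ (covers j)

  enumerable⇒finite : Decidable _≈_ → Enumerable → FiniteSetoid A
  enumerable⇒finite _≟_ (K , e , enumerates) with deduplicate _≟_ e
  ... | N , d , injective , covers = N , record
    { to        = d
    ; from      = code
    ; to-cong   = λ { refl → ≈-refl }
    ; from-cong = code-cong
    ; inverse   = (λ { refl → decode _ }) , λ {p} eq → ≡.trans (code-cong eq) (injective _ _ (decode (d p)))
    }
    where
      code : X → Fin N
      code a = proj₁ (covers (proj₁ (enumerates a)))

      decode : ∀ a → d (code a) ≈ a
      decode a = trans (proj₂ (covers (proj₁ (enumerates a)))) (proj₂ (enumerates a))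

      code-cong : ∀ {a b} → a ≈ b → code a ≡ code b
      code-cong {a} {b} a≈b = injective _ _ (trans (decode a) (trans a≈b (sym (decode b))))

  compact : ∀ {K} (e : Fin K → Maybe X) →
    ∃ λ N → Σ (Fin N → X) λ g → ∀ j {a} → Pointwise _≈_ (e j) (just a) → ∃ λ p → g p ≈ a
  compact {zero} e = 0 , (λ ()) , λ ()
  compact {suc K} e with compact (e ∘ suc) | e zero in e₀≡
  ... | N , g , covers | nothing = N , g , λ
    { zero  e₀≈a → case-nothing (≡.subst (λ m → Pointwise _≈_ m _) e₀≡ e₀≈a)
    ; (suc j) → covers j }
    where
      case-nothing : ∀ {a} → Pointwise _≈_ nothing (just a) → ∃ λ p → g p ≈ a
      case-nothing ()
  ... | N , g , covers | just x = suc N , g′ , λ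
    { zero  e₀≈a → zero , drop-just (≡.subst (λ m → Pointwise _≈_ m _) e₀≡ e₀≈a)
    ; (suc j) eⱼ≈a → suc (proj₁ (covers j eⱼ≈a)) , proj₂ (covers j eⱼ≈a) }
    where
      g′ : Fin (suc N) → X
      g′ zero = x
      g′ (suc p) = g p

  -- The n-tuples over an enumerable setoid are enumerable (pointwise ≈):
  -- a tuple of codes in Fin K is itself coded by an element of Fin (K ^ n).
  tuples : Enumerable → ∀ n →
    ∃ λ K → Σ (Fin K → Fin n → X) λ F → ∀ (t : Fin n → X) → ∃ λ j → ∀ l → F j l ≈ t l
  tuples (K , e , enumerates) n =
    K ^ n , (λ j l → e (finToFun j l)) , λ t → funToFin (codes t) , λ l →
      trans (reflexive (≡.cong e (finToFun-funToFin (codes t) l))) (proj₂ (enumerates (t l)))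
    where
      codes : (Fin n → X) → Fin n → Fin K
      codes t l = proj₁ (enumerates (t l))

identityAutomorphism : (S : Semigroup 0ℓ 0ℓ) → Automorphism S
identityAutomorphism S = record
  { bij = Identity.inverse (Semigroup.setoid S)
  ; hom = λ _ _ → Semigroup.refl S }

-- Already the identity automorphism leaves only finitely many orbits,
-- since S^n itself is enumerable.
finite⇒ℵ₀-categorical : (S : Semigroup 0ℓ 0ℓ) → FiniteSemigroup S → ℵ₀-categorical S
finite⇒ℵ₀-categorical S finite n _ with tuples (finite⇒enumerable finite) n
  where open Enumeration (Semigroup.setoid S)
... | K , F , enumerates = K , F , λ t → proj₁ (enumerates t) , identityAutomorphism S , proj₂ (enumerates t)

module Components {I : Set} (_≟_ : DecidableEquality I) (M : I → Semigroup 0ℓ 0ℓ) where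
  open DirectSum M hiding (directSum)

  S : Semigroup 0ℓ 0ℓ
  S = directSum M

  -- Mᵢ¹: the semigroup Mᵢ with an identity 'nothing' adjoined.
  M¹ : I → Set
  M¹ i = Maybe (Semigroup.Carrier (M i))

  M¹-setoid : I → Setoid 0ℓ 0ℓ
  M¹-setoid i = Pointwise.setoid (Semigroup.setoid (M i))

  _≈¹_ : ∀ {i} → M¹ i → M¹ i → Set
  _≈¹_ {i} = Setoid._≈_ (M¹-setoid i)

  _∙¹_ : ∀ {i} → M¹ i → M¹ i → M¹ i
  _∙¹_ {i} (just a) (just b) = just (Semigroup._∙_ (M i) a b)
  just a ∙¹ nothing = just a
  nothing ∙¹ y = y

  ∙¹-cong : ∀ {i} {a a′ b b′ : M¹ i} → a ≈¹ a′ → b ≈¹ b′ → (a ∙¹ b) ≈¹ (a′ ∙¹ b′)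
  ∙¹-cong {i} (just p) (just q) = just (Semigroup.∙-cong (M i) p q)
  ∙¹-cong (just p) nothing = just p
  ∙¹-cong nothing q = q

  ∙¹-assoc : ∀ {i} (a b c : M¹ i) → ((a ∙¹ b) ∙¹ c) ≈¹ (a ∙¹ (b ∙¹ c))
  ∙¹-assoc {i} (just a) (just b) (just c) = just (Semigroup.assoc (M i) a b c)
  ∙¹-assoc {i} (just a) (just b) nothing = Setoid.refl (M¹-setoid i)
  ∙¹-assoc {i} (just a) nothing c = Setoid.refl (M¹-setoid i)
  ∙¹-assoc {i} nothing b c = Setoid.refl (M¹-setoid i)

  ∙¹-identityʳ : ∀ {i} (a : M¹ i) → a ≈¹ (a ∙¹ nothing)
  ∙¹-identityʳ {i} (just a) = Setoid.refl (M¹-setoid i)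
  ∙¹-identityʳ nothing = nothing

  ∙¹-zeroFree : ∀ {i} (a b : M¹ i) → a ∙¹ b ≡ nothing → a ≡ nothing × b ≡ nothing
  ∙¹-zeroFree (just a) (just b) ()
  ∙¹-zeroFree (just a) nothing ()
  ∙¹-zeroFree nothing b eq = refl , eq

  component : (k : I) → List Gen → M¹ k
  component k [] = nothing
  component k ((j , m) ∷ xs) with j ≟ k
  ... | yes refl = just m ∙¹ component k xs
  ... | no _ = component k xs

  component-here : ∀ k m xs → component k ((k , m) ∷ xs) ≡ just m ∙¹ component k xs
  component-here k m xs with k ≟ k
  ... | yes refl = refl
  ... | no k≢k = ⊥-elim (k≢k refl)

  component-there : ∀ {j} k m xs → j ≢ k → component k ((j , m) ∷ xs) ≡ component k xs
  component-there {j} k m xs j≢k with j ≟ k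
  ... | yes refl = ⊥-elim (j≢k refl)
  ... | no _ = refl

  component-++ : ∀ k xs ys → component k (xs ++ ys) ≈¹ (component k xs ∙¹ component k ys)
  component-++ k [] ys = Setoid.refl (M¹-setoid k)
  component-++ k ((j , m) ∷ xs) ys with j ≟ k
  ... | yes refl = Setoid.trans (M¹-setoid k)
          (∙¹-cong (Setoid.refl (M¹-setoid k) {just m}) (component-++ k xs ys))
          (Setoid.sym (M¹-setoid k) (∙¹-assoc (just m) (component k xs) (component k ys)))
  ... | no _ = component-++ k xs ys

  component-∉ : ∀ k xs → k ∉ map proj₁ xs → component k xs ≡ nothing
  component-∉ k [] _ = refl
  component-∉ k ((j , m) ∷ xs) k∉ with j ≟ k
  ... | yes refl = ⊥-elim (k∉ (here refl))
  ... | no _ = component-∉ k xs (k∉ ∘ there)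

  componentʷ : (k : I) → Word → M¹ k
  componentʷ k w = component k (toList w)

  component-resp : ∀ {u v} → u ~ v → ∀ k → componentʷ k u ≈¹ componentʷ k v
  component-resp (rel-eq {i} p) k with i ≟ k
  ... | yes refl = just p
  ... | no _ = nothing
  component-resp (rel-mul {i} m m′) k with i ≟ k
  ... | yes refl rewrite component-here k m′ [] = Setoid.refl (M¹-setoid k)
  ... | no i≢k rewrite component-there k m′ [] i≢k = nothing
  component-resp (rel-comm {i} {j} i≢j m n) k with i ≟ k | j ≟ k
  ... | yes refl | yes refl = ⊥-elim (i≢j refl)
  ... | yes refl | no j≢k rewrite component-there k n [] j≢k | component-here k m [] = Setoid.refl (M¹-setoid k)
  ... | no i≢k | yes refl rewrite component-there k m [] i≢k | component-here k n [] = Setoid.refl (M¹-setoid k)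
  ... | no i≢k | no j≢k rewrite component-there k m [] i≢k | component-there k n [] j≢k = nothing
  component-resp ~-refl k = Setoid.refl (M¹-setoid k)
  component-resp (~-sym p) k = Setoid.sym (M¹-setoid k) (component-resp p k)
  component-resp (~-trans p q) k = Setoid.trans (M¹-setoid k) (component-resp p k) (component-resp q k)
  component-resp (~-congˡ {u} {v} w p) k = begin
    component k (toList w ++ toList u)          ≈⟨ component-++ k (toList w) (toList u) ⟩
    componentʷ k w ∙¹ componentʷ k u            ≈⟨ ∙¹-cong (Setoid.refl (M¹-setoid k)) (component-resp p k) ⟩
    componentʷ k w ∙¹ componentʷ k v            ≈⟨ component-++ k (toList w) (toList v) ⟨
    component k (toList w ++ toList v)          ∎
    where open SetoidReasoning (M¹-setoid k)
  component-resp (~-congʳ {u} {v} w p) k = begin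
    component k (toList u ++ toList w)          ≈⟨ component-++ k (toList u) (toList w) ⟩
    componentʷ k u ∙¹ componentʷ k w            ≈⟨ ∙¹-cong (component-resp p k) (Setoid.refl (M¹-setoid k)) ⟩
    componentʷ k v ∙¹ componentʷ k w            ≈⟨ component-++ k (toList v) (toList w) ⟨
    component k (toList v ++ toList w)          ∎
    where open SetoidReasoning (M¹-setoid k)

  distinct-letters : ∀ {i j} {m n} → i ≢ j → ¬ (gen i m ~ gen j n)
  distinct-letters {i} {j} {m} {n} i≢j eq
    with component-resp eq i
  ... | eqᵢ rewrite component-here i m [] | component-there i n [] (i≢j ∘ ≡.sym) with eqᵢ
  ... | ()

  -- S¹: the monoid S with an identity 'nothing' adjoined.
  Word¹ : Set
  Word¹ = Maybe Word

  Word¹-setoid : Setoid 0ℓ 0ℓ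
  Word¹-setoid = Pointwise.setoid (Semigroup.setoid S)

  open Setoid Word¹-setoid public using () renaming (_≈_ to _≋_)
  open Setoid Word¹-setoid using () renaming (refl to ≋-refl; sym to ≋-sym; trans to ≋-trans; reflexive to ≋-reflexive)

  _·_ : Word¹ → Word¹ → Word¹
  nothing · y = y
  just u · nothing = just u
  just u · just v = just (u ⁺++⁺ v)

  ·-cong : ∀ {a a′ b b′} → a ≋ a′ → b ≋ b′ → (a · b) ≋ (a′ · b′)
  ·-cong (just p) (just q) = just (Semigroup.∙-cong S p q)
  ·-cong (just p) nothing = just p
  ·-cong nothing q = q

  ·-assoc : ∀ a b c → ((a · b) · c) ≋ (a · (b · c))
  ·-assoc (just a) (just b) (just c) = just (Semigroup.assoc S a b c)
  ·-assoc (just a) (just b) nothing = ≋-refl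
  ·-assoc (just a) nothing c = ≋-refl
  ·-assoc nothing b c = ≋-refl

  component¹ : (k : I) → Word¹ → M¹ k
  component¹ k nothing = nothing
  component¹ k (just u) = componentʷ k u

  component¹-· : ∀ k a b → component¹ k (a · b) ≈¹ (component¹ k a ∙¹ component¹ k b)
  component¹-· k nothing b = Setoid.refl (M¹-setoid k)
  component¹-· k (just u) nothing = ∙¹-identityʳ (componentʷ k u)
  component¹-· k (just u) (just v) = component-++ k (toList u) (toList v)

  component¹-resp : ∀ k {a b} → a ≋ b → component¹ k a ≈¹ component¹ k b
  component¹-resp k (just p) = component-resp p k
  component¹-resp k nothing = nothing

  ⟦_⟧ : List Gen → Word¹
  ⟦ [] ⟧ = nothing
  ⟦ x ∷ xs ⟧ = just (x ∷ xs)

  ⟦⟧-∷ : ∀ x xs → ⟦ x ∷ xs ⟧ ≋ (just [ x ] · ⟦ xs ⟧)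
  ⟦⟧-∷ x [] = ≋-refl
  ⟦⟧-∷ x (y ∷ ys) = ≋-refl

  ⟦⟧-++ : ∀ xs ys → ⟦ xs ++ ys ⟧ ≋ (⟦ xs ⟧ · ⟦ ys ⟧)
  ⟦⟧-++ [] ys = ≋-refl
  ⟦⟧-++ (x ∷ xs) [] = ≋-reflexive (≡.cong (λ l → just (x ∷ l)) (++-identityʳ xs))
  ⟦⟧-++ (x ∷ xs) (y ∷ ys) = ≋-refl

  inject : (i : I) → M¹ i → Word¹
  inject i nothing = nothing
  inject i (just m) = just (gen i m)

  inject-cong : ∀ {i} {a b : M¹ i} → a ≈¹ b → inject i a ≋ inject i b
  inject-cong (just p) = just (rel-eq p)
  inject-cong nothing = nothing

  inject-∙ : ∀ i m c → (just (gen i m) · inject i c) ≋ inject i (just m ∙¹ c)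
  inject-∙ i m nothing = ≋-refl
  inject-∙ i m (just m′) = just (rel-mul m m′)

  inject-comm : ∀ {i j} m c → j ≢ i → (just (gen j m) · inject i c) ≋ (inject i c · just (gen j m))
  inject-comm m nothing j≢i = ≋-refl
  inject-comm m (just m′) j≢i = just (rel-comm j≢i m m′)

  delete : I → List Gen → List Gen
  delete i [] = []
  delete i ((j , m) ∷ xs) with j ≟ i
  ... | yes _ = delete i xs
  ... | no _ = (j , m) ∷ delete i xs

  delete-here : ∀ i xs → component i (delete i xs) ≡ nothing
  delete-here i [] = refl
  delete-here i ((j , m) ∷ xs) with j ≟ i
  ... | yes _ = delete-here i xs
  ... | no j≢i rewrite component-there i m (delete i xs) j≢i = delete-here i xs

  delete-there : ∀ {k} i xs → k ≢ i → component k (delete i xs) ≡ component k xs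
  delete-there i [] k≢i = refl
  delete-there {k} i ((j , m) ∷ xs) k≢i with j ≟ i
  ... | yes refl = ≡.sym (≡.trans (component-there k m xs (k≢i ∘ ≡.sym)) (≡.sym (delete-there i xs k≢i)))
  ... | no _ with j ≟ k
  ...   | yes refl = ≡.cong (just m ∙¹_) (delete-there i xs k≢i)
  ...   | no _ = delete-there i xs k≢i

  collect : ∀ i xs → ⟦ xs ⟧ ≋ (inject i (component i xs) · ⟦ delete i xs ⟧)
  collect i [] = nothing
  collect i ((j , m) ∷ xs) with j ≟ i
  ... | yes refl = begin
    ⟦ (i , m) ∷ xs ⟧                                         ≈⟨ ⟦⟧-∷ (i , m) xs ⟩
    just [ (i , m) ] · ⟦ xs ⟧                                ≈⟨ ·-cong ≋-refl (collect i xs) ⟩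
    just [ (i , m) ] · (inject i cᵢ · ⟦ delete i xs ⟧)       ≈⟨ ·-assoc (just [ (i , m) ]) (inject i cᵢ) _ ⟨
    (just [ (i , m) ] · inject i cᵢ) · ⟦ delete i xs ⟧       ≈⟨ ·-cong (inject-∙ i m cᵢ) ≋-refl ⟩
    inject i (just m ∙¹ cᵢ) · ⟦ delete i xs ⟧                ∎
    where open SetoidReasoning Word¹-setoid
          cᵢ = component i xs
  ... | no j≢i = begin
    ⟦ (j , m) ∷ xs ⟧                                         ≈⟨ ⟦⟧-∷ (j , m) xs ⟩
    just [ (j , m) ] · ⟦ xs ⟧                                ≈⟨ ·-cong ≋-refl (collect i xs) ⟩
    just [ (j , m) ] · (inject i cᵢ · ⟦ delete i xs ⟧)       ≈⟨ ·-assoc (just [ (j , m) ]) (inject i cᵢ) _ ⟨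
    (just [ (j , m) ] · inject i cᵢ) · ⟦ delete i xs ⟧       ≈⟨ ·-cong (inject-comm m cᵢ j≢i) ≋-refl ⟩
    (inject i cᵢ · just [ (j , m) ]) · ⟦ delete i xs ⟧       ≈⟨ ·-assoc (inject i cᵢ) (just [ (j , m) ]) _ ⟩
    inject i cᵢ · (just [ (j , m) ] · ⟦ delete i xs ⟧)       ≈⟨ ·-cong (≋-refl {inject i cᵢ}) (⟦⟧-∷ (j , m) (delete i xs)) ⟨
    inject i cᵢ · ⟦ (j , m) ∷ delete i xs ⟧                  ∎
    where open SetoidReasoning Word¹-setoid
          cᵢ = component i xs

  Vector : Set
  Vector = (k : I) → M¹ k

  _≗¹_ : Vector → Vector → Set
  c ≗¹ c′ = ∀ k → c k ≈¹ c′ k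

  components : List Gen → Vector
  components xs k = component k xs

  erase : I → Vector → Vector
  erase i c k with k ≟ i
  ... | yes _ = nothing
  ... | no _ = c k

  erase-cong : ∀ i {c c′} → c ≗¹ c′ → erase i c ≗¹ erase i c′
  erase-cong i p k with k ≟ i
  ... | yes _ = nothing
  ... | no _ = p k

  components-delete : ∀ i xs → components (delete i xs) ≗¹ erase i (components xs)
  components-delete i xs k with k ≟ i
  ... | yes refl = Setoid.reflexive (M¹-setoid k) (delete-here k xs)
  ... | no k≢i = Setoid.reflexive (M¹-setoid k) (delete-there i xs k≢i)

  -- The normal form of a component vector along a list L of indices:
  -- the product of the components at the indices of L (each used once).
  normalForm : List I → Vector → Word¹
  normalForm [] c = nothing
  normalForm (i ∷ L) c = inject i (c i) · normalForm L (erase i c)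

  normalForm-cong : ∀ L {c c′} → c ≗¹ c′ → normalForm L c ≋ normalForm L c′
  normalForm-cong [] p = nothing
  normalForm-cong (i ∷ L) p = ·-cong (inject-cong (p i)) (normalForm-cong L (erase-cong i p))

  Covers : List I → List Gen → Set
  Covers L xs = ∀ k → k ∉ L → component k xs ≡ nothing

  trivial-components : ∀ xs → (∀ k → component k xs ≡ nothing) → xs ≡ []
  trivial-components [] _ = refl
  trivial-components ((j , m) ∷ xs) trivial
    with () ← proj₁ (∙¹-zeroFree (just m) (component j xs) (≡.trans (≡.sym (component-here j m xs)) (trivial j)))

  normalForm-correct : ∀ L xs → Covers L xs → ⟦ xs ⟧ ≋ normalForm L (components xs)
  normalForm-correct [] xs covered
    rewrite trivial-components xs (λ k → covered k λ ()) = nothing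
  normalForm-correct (i ∷ L) xs covered =
    ≋-trans (collect i xs)
      (·-cong ≋-refl (≋-trans (normalForm-correct L (delete i xs) covered′)
                              (normalForm-cong L (components-delete i xs))))
    where
      covered′ : Covers L (delete i xs)
      covered′ k k∉L with k ≟ i
      ... | yes refl = delete-here k xs
      ... | no k≢i = ≡.trans (delete-there i xs k≢i)
                       (covered k λ { (here k≡i) → k≢i k≡i ; (there k∈L) → k∉L k∈L })

  complete : ∀ L (u v : Word) → Covers L (toList u) → Covers L (toList v) →
             components (toList u) ≗¹ components (toList v) → u ~ v
  complete L (x ∷ xs) (y ∷ ys) covered-u covered-v eq = drop-just (begin
    ⟦ x ∷ xs ⟧                            ≈⟨ normalForm-correct L (x ∷ xs) covered-u ⟩
    normalForm L (components (x ∷ xs))    ≈⟨ normalForm-cong L eq ⟩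
    normalForm L (components (y ∷ ys))    ≈⟨ normalForm-correct L (y ∷ ys) covered-v ⟨
    ⟦ y ∷ ys ⟧                            ∎)
    where open SetoidReasoning Word¹-setoid

  -- When all Mᵢ are finite, the words covered by a finite list L of indices
  -- fall into finitely many classes: list the normal forms along L.
  module _ (finite : ∀ i → FiniteSemigroup (M i)) where

    enumerate-M¹ : ∀ i → ∃ λ K → Σ (Fin K → M¹ i) λ e → ∀ a → ∃ λ q → e q ≈¹ a
    enumerate-M¹ i with Enumeration.finite⇒enumerable (Semigroup.setoid (M i)) (finite i)
    ... | n , e , enumerates = suc n , e¹ , enumerates¹
      where
        e¹ : Fin (suc n) → M¹ i
        e¹ zero = nothing
        e¹ (suc p) = just (e p)
        enumerates¹ : ∀ a → ∃ λ q → e¹ q ≈¹ a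
        enumerates¹ nothing = zero , nothing
        enumerates¹ (just a) = suc (proj₁ (enumerates a)) , just (proj₂ (enumerates a))

    normalForms : ∀ L → ∃ λ K → Σ (Fin K → Word¹) λ f → ∀ c → ∃ λ q → f q ≋ normalForm L c
    normalForms [] = 1 , (λ _ → nothing) , λ c → zero , nothing
    normalForms (i ∷ L) with enumerate-M¹ i | normalForms L
    ... | K₁ , e , enumerates | K₂ , f , listsNF = K₁ ℕ.* K₂ , f′ ∘ remQuot K₂ , listsNF′
      where
        f′ : Fin K₁ × Fin K₂ → Word¹
        f′ (p , q) = inject i (e p) · f q
        listsNF′ : ∀ c → ∃ λ q → f′ (remQuot K₂ q) ≋ normalForm (i ∷ L) c
        listsNF′ c = combine p q , ≋-trans (≋-reflexive (≡.cong f′ (remQuot-combine p q)))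
                                      (·-cong (inject-cong (proj₂ (enumerates (c i))))
                                              (proj₂ (listsNF (erase i c))))
          where
            p = proj₁ (enumerates (c i))
            q = proj₁ (listsNF (erase i c))

    coveredWords : ∀ L → ∃ λ K → Σ (Fin K → Word¹) λ f →
                   ∀ (u : Word) → Covers L (toList u) → ∃ λ q → f q ≋ just u
    coveredWords L with normalForms L
    ... | K , f , listsNF = K , f , λ { u@(x ∷ xs) covered →
      let q , fq≋nf = listsNF (components (toList u)) in
      q , ≋-trans fq≋nf (≋-sym (normalForm-correct L (x ∷ xs) covered)) }

  module _ (L : List I) (listed : ∀ k → k ∈ L) (finite : ∀ i → FiniteSemigroup (M i)) where

    covered : ∀ xs → Covers L xs
    covered xs k k∉L = ⊥-elim (k∉L (listed k))

    open Enumeration (Semigroup.setoid S) using (compact; enumerable⇒finite)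

    ≈-decidable : ∀ i → Decidable (Semigroup._≈_ (M i))
    ≈-decidable i = Enumeration.finite⇒decidable (Semigroup.setoid (M i)) (finite i)

    -- Equality in S is decided by comparing the components.
    ~-decidable : Decidable _~_
    ~-decidable u v
      with All.all? (λ k → Pointwise.dec (≈-decidable k) (componentʷ k u) (componentʷ k v)) L
    ... | yes equal = yes (complete L u v (covered _) (covered _) (λ k → All.lookup equal (listed k)))
    ... | no unequal = no λ u~v → unequal (All.tabulate λ {k} _ → component-resp u~v k)

    -- All words are covered by L; dropping the empty word from the list of
    -- their classes leaves an enumeration of S.
    directSum-finite : FiniteSemigroup S
    directSum-finite with coveredWords finite L
    ... | K , f , lists with compact f
    ... | N , g , covers = enumerable⇒finite ~-decidable
            (N , g , λ u → covers (proj₁ (lists u (covered _))) (proj₂ (lists u (covered _))))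

  Factor : Word → Word → Set
  Factor y r = ∃₂ λ P Q → just r ≋ (P · (just y · Q))

  letter-factor : ∀ (w : Word) {x} → x ∈ toList w → Factor [ x ] w
  letter-factor (y ∷ ys) x∈w with ∈-∃++ x∈w
  ... | pre , post , w≡ = ⟦ pre ⟧ , ⟦ post ⟧ , (begin
    ⟦ y ∷ ys ⟧                            ≡⟨ ≡.cong ⟦_⟧ w≡ ⟩
    ⟦ pre ++ _ ∷ post ⟧                    ≈⟨ ⟦⟧-++ pre (_ ∷ post) ⟩
    ⟦ pre ⟧ · ⟦ _ ∷ post ⟧                 ≈⟨ ·-cong ≋-refl (⟦⟧-∷ _ post) ⟩
    ⟦ pre ⟧ · (just [ _ ] · ⟦ post ⟧)      ∎)
    where open SetoidReasoning Word¹-setoid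

  -- Factors of a word covered by L are covered by L, since Mₖ¹ has no
  -- nontrivial factorisations of the identity.
  factor-covered : ∀ L {y r} → Covers L (toList r) → Factor y r → Covers L (toList y)
  factor-covered L {y} {r} covered (P , Q , r≋PyQ) k k∉L =
    proj₁ (∙¹-zeroFree (componentʷ k y) (component¹ k Q)
      (proj₂ (∙¹-zeroFree (component¹ k P) _ (nothing-inv (begin
        nothing                                              ≡⟨ covered k k∉L ⟨
        componentʷ k r                                       ≈⟨ component¹-resp k r≋PyQ ⟩
        component¹ k (P · (just y · Q))                      ≈⟨ component¹-· k P _ ⟩
        component¹ k P ∙¹ component¹ k (just y · Q)          ≈⟨ ∙¹-cong (Setoid.refl (M¹-setoid k)) (component¹-· k (just y) Q) ⟩
        component¹ k P ∙¹ (componentʷ k y ∙¹ component¹ k Q) ∎)))))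
    where open SetoidReasoning (M¹-setoid k)

  -- An automorphism α is also a homomorphism in the inverse direction, so
  -- α⁻¹ maps factors of w = α(r) to factors of r.
  module _ (α : Automorphism S) where
    open Inverse (Automorphism.bij α)
    open Automorphism α using (hom)

    from-hom : ∀ u v → from (u ⁺++⁺ v) ~ (from u ⁺++⁺ from v)
    from-hom u v = ~-trans (from-cong (~-sym to-product)) (strictlyInverseʳ _)
      where
        to-product : to (from u ⁺++⁺ from v) ~ (u ⁺++⁺ v)
        to-product = ~-trans (hom _ _) (Semigroup.∙-cong S (strictlyInverseˡ u) (strictlyInverseˡ v))

    from¹ : Word¹ → Word¹
    from¹ nothing = nothing
    from¹ (just u) = just (from u)

    from¹-· : ∀ a b → from¹ (a · b) ≋ (from¹ a · from¹ b)
    from¹-· nothing b = ≋-refl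
    from¹-· (just u) nothing = ≋-refl
    from¹-· (just u) (just v) = just (from-hom u v)

    from¹-cong : ∀ {a b} → a ≋ b → from¹ a ≋ from¹ b
    from¹-cong (just p) = just (from-cong p)
    from¹-cong nothing = nothing

    from-factor : ∀ {y r w} → to r ~ w → Factor y w → Factor (from y) r
    from-factor {y} {r} {w} αr~w (P , Q , w≋PyQ) = from¹ P , from¹ Q , (begin
      just r                              ≈⟨ just (strictlyInverseʳ r) ⟨
      just (from (to r))                  ≈⟨ just (from-cong αr~w) ⟩
      from¹ (just w)                      ≈⟨ from¹-cong w≋PyQ ⟩
      from¹ (P · (just y · Q))            ≈⟨ from¹-· P _ ⟩
      from¹ P · from¹ (just y · Q)        ≈⟨ ·-cong ≋-refl (from¹-· (just y) Q) ⟩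
      from¹ P · (just (from y) · from¹ Q) ∎)
      where open SetoidReasoning Word¹-setoid

    few-distinct-letters : ∀ {L K} (f : Fin K → Word¹) →
      (∀ (u : Word) → Covers L (toList u) → ∃ λ q → f q ≋ just u) →
      ∀ {r w} → Covers L (toList r) → to r ~ w →
      (e : Fin (suc K) → Gen) → (∀ a → e a ∈ toList w) →
      ∃₂ λ a b → a ≢ b × [ e a ] ~ [ e b ]
    few-distinct-letters {L} {K} f lists {r} {w} covered αr~w e e∈w =
      a , b , <⇒≢ a<b , (begin
        [ e a ]            ≈⟨ strictlyInverseˡ [ e a ] ⟨
        to (preimage a)    ≈⟨ to-cong (drop-just (≋-trans (≋-sym (class a))
                                  (≋-trans (≋-reflexive (≡.cong f same)) (class b)))) ⟩
        to (preimage b)    ≈⟨ strictlyInverseˡ [ e b ] ⟩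
        [ e b ]            ∎)
      where
        open SetoidReasoning (Semigroup.setoid S)

        preimage : Fin (suc K) → Word
        preimage a = from [ e a ]

        preimage-covered : ∀ a → Covers L (toList (preimage a))
        preimage-covered a = factor-covered L covered (from-factor αr~w (letter-factor w (e∈w a)))

        code : Fin (suc K) → Fin K
        code a = proj₁ (lists (preimage a) (preimage-covered a))

        class : ∀ a → f (code a) ≋ just (preimage a)
        class a = proj₂ (lists (preimage a) (preimage-covered a))

        collision = pigeonhole (n<1+n K) code
        a = proj₁ collision
        b = proj₁ (proj₂ collision)
        a<b = proj₁ (proj₂ (proj₂ collision))
        same = proj₂ (proj₂ (proj₂ collision))

module InfiniteIndex {I : Set} (_≟_ : DecidableEquality I) (ι : ℕ → I)
  (ι-injective : ∀ {m n} → ι m ≡ ι n → m ≡ n) (M : I → Semigroup 0ℓ 0ℓ)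
  (finite : ∀ i → FiniteSemigroup (M i)) (element : ∀ i → Semigroup.Carrier (M i)) where

  open DirectSum M hiding (directSum)
  open Components _≟_ M

  letter : ∀ {n} → Fin n → Gen
  letter a = ι (toℕ a) , element (ι (toℕ a))

  word : ℕ → Word
  word K = letter {suc K} zero ∷ map (letter ∘ suc) (allFin K)

  letter∈word : ∀ K (a : Fin (suc K)) → letter a ∈ toList (word K)
  letter∈word K zero = here refl
  letter∈word K (suc a) = there (∈-map⁺ (letter ∘ suc) (∈-allFin a))

  supports : ∀ {k} → (Fin k → Word) → List I
  supports {zero} r = []
  supports {suc k} r = map proj₁ (toList (r zero)) ++ supports (r ∘ suc)

  supports-cover : ∀ {k} (r : Fin k → Word) j → Covers (supports r) (toList (r j))
  supports-cover r j k k∉ = component-∉ k (toList (r j)) (k∉ ∘ ⊆-supports r j)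
    where
      ⊆-supports : ∀ {k} (r : Fin k → Word) j {x} → x ∈ map proj₁ (toList (r j)) → x ∈ supports r
      ⊆-supports r zero x∈ = ∈-++⁺ˡ x∈
      ⊆-supports r (suc j) x∈ = ∈-++⁺ʳ _ (⊆-supports (r ∘ suc) j x∈)

  not-ℵ₀-categorical : ¬ ℵ₀-categorical S
  not-ℵ₀-categorical categorical with categorical 1 (s≤s z≤n)
  ... | k , reps , orbit with coveredWords finite (supports (λ j → reps j zero))
  ... | K , f , lists with orbit (λ _ → word K)
  ... | j , α , αr≈w = no-collision (few-distinct-letters α f lists (supports-cover (λ j → reps j zero) j)
                                 (αr≈w zero) letter (letter∈word K))
    where
      no-collision : (∃₂ λ a b → a ≢ b × [ letter {suc K} a ] ~ [ letter b ]) → ⊥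
      no-collision (a , b , a≢b , ea~eb) =
        distinct-letters (λ ιa≡ιb → a≢b (toℕ-injective (ι-injective ιa≡ιb))) ea~eb

proposition5p3 : (I : Set) → Countable I →
    (M : I → Semigroup 0ℓ 0ℓ) → (∀ i → FiniteSemigroup (M i)) →
    (∀ i → Semigroup.Carrier (M i)) →
    (ℵ₀-categorical (directSum M) ⇔ FiniteType I)
      × (FiniteType I → FiniteSemigroup (directSum M))
proposition5p3 I countable M finite element =
  mk⇔ categorical⇒finite (finite⇒ℵ₀-categorical _ ∘ sum-finite) , sum-finite
  where
    sum-finite : FiniteType I → FiniteSemigroup (directSum M)
    sum-finite (n , φ) = Components.directSum-finite (via-injection (↔⇒↣ φ) Fin._≟_) M
      (map from (allFin n)) (λ k → ≡.subst (_∈ _) (strictlyInverseʳ k) (∈-map⁺ from (∈-allFin (to k))))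
      finite
      where open Inverse φ

    not-categorical : I ↔ ℕ → ¬ ℵ₀-categorical (directSum M)
    not-categorical ψ = InfiniteIndex.not-ℵ₀-categorical (via-injection (↔⇒↣ ψ) ℕ._≟_)
      (Inverse.from ψ) (Injection.injective (↔⇒↣ (Symmetry.↔-sym ψ))) M finite element

    categorical⇒finite : ℵ₀-categorical (directSum M) → FiniteType I
    categorical⇒finite categorical =
      [ (λ I-finite → I-finite) , (λ ψ → ⊥-elim (not-categorical ψ categorical)) ]′ countable
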